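{- In the solution maintained by the Duo-Halve algorithm, if both endpoints of $e_1$ are accepted, then every minimum vertex cover $\mathrm{OPT}$ of the current graph contains at least two vertices of $e_1\cup(V\setminus V_M)$, and $\frac{|\mathrm{DH}|}{|\mathrm{OPT}|}\le 2-\frac{2}{|\mathrm{OPT}|}$, where $\mathrm{DH}$ is Duo-Halve's vertex cover and $V$ the set of revealed vertices.
   Context: Online vertex cover (vertex-arrival): vertices of an unknown graph arrive one at a time with their edges to previously revealed vertices; the algorithm maintains a set of accepted vertices covering all revealed edges, and may late-accept or late-reject vertices. Duo-Halve algorithm: it maintains a matching $M$ built incrementally (edges never removed); $V_M$ denotes the saturated vertices; vertices outside $V_M$ are always rejected. $e_1,e_2$ denote the most recently and second most recently added matching edges (here "$e_1\cup(V\setminus V_M)$" means the two endpoints of $e_1$ together with the unsaturated vertices); a matching edge is full if both endpoints are accepted, half otherwise. When a new vertex $v$ arrives: if $v$ has a neighbor $p\notin V_M$ (chosen arbitrarily), $(p,v)$ is added to $M$, the old $e_1$ becomes $e_2$ and $(p,v)$ becomes $e_1$. Then every rejected vertex of $V_M$ adjacent to $v$ not an endpoint of $e_1,e_2$ is late-accepted, and HalveBoth chooses statuses of the endpoints of $e_1,e_2$ among those yielding a valid vertex cover, minimizing the number of accepted endpoints of $e_1,e_2$, with ties broken in favour of accepting fewer endpoints of $e_1$ and then fewer late operations. -}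

module Defs where

open import Data.Nat using (ℕ; zero; suc; _+_; _*_; _≤_; _<_; _≡ᵇ_)
open import Data.Bool using (Bool; true; false; _∧_; _∨_; not; _xor_; if_then_else_)
open import Data.List using (List; []; _∷_; length; filterᵇ)
open import Data.Bool.ListAction using (any)
open import Data.Product using (_×_; _,_; proj₁; proj₂)
open import Data.Sum using (_⊎_)
open import Data.Empty using (⊥)
open import Relation.Binary.PropositionalEquality using (_≡_)
open import Data.List.Membership.Propositional using (_∈_)
open import Data.List.Relation.Unary.All using (All)

-- Vertices are 0,1,2,...  in arrival order.  An input prefix is a list of
-- neighbour lists, MOST RECENT ARRIVAL FIRST: in  (ns ∷ G)  the head
-- vertex is  length G  and  ns  lists its neighbours among 0 .. length G - 1.

Input : Set
Input = List (List ℕ)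

elem : ℕ → List ℕ → Bool
elem u ns = any (u ≡ᵇ_) ns

Edge : Input → ℕ → ℕ → Set
Edge []       u w = ⊥
Edge (ns ∷ G) u w =
  (w ≡ length G × elem u ns ≡ true)
  ⊎ (u ≡ length G × elem w ns ≡ true)
  ⊎ Edge G u w

-- vertex sets as Boolean predicates; only vertices < n are counted
VSet : Set
VSet = ℕ → Bool

count : ℕ → VSet → ℕ
count zero    C = 0
count (suc n) C = (if C n then 1 else 0) + count n C

IsVC : Input → VSet → Set
IsVC G C = ∀ u w → Edge G u w → C u ≡ true ⊎ C w ≡ true

IsMinVC : Input → VSet → Set
IsMinVC G C = IsVC G C × (∀ C' → IsVC G C' → count (length G) C ≤ count (length G) C')

-- Matchings: list of edges, most recently added first.
-- e₁ = head, e₂ = second element.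

Matching : Set
Matching = List (ℕ × ℕ)

endpoint : ℕ × ℕ → ℕ → Bool
endpoint e u = (proj₁ e ≡ᵇ u) ∨ (proj₂ e ≡ᵇ u)

saturated : Matching → ℕ → Bool
saturated M u = any (λ e → endpoint e u) M

inE1 : Matching → ℕ → Bool
inE1 []      u = false
inE1 (e ∷ _) u = endpoint e u

inE2 : Matching → ℕ → Bool
inE2 []          u = false
inE2 (_ ∷ [])    u = false
inE2 (_ ∷ f ∷ _) u = endpoint f u

ends1 : Matching → List ℕ
ends1 []            = []
ends1 ((a , b) ∷ _) = a ∷ b ∷ []

ends12 : Matching → List ℕ
ends12 []                        = []
ends12 ((a , b) ∷ [])            = a ∷ b ∷ []
ends12 ((a , b) ∷ (c , d) ∷ _)   = a ∷ b ∷ c ∷ d ∷ []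

countL : List ℕ → VSet → ℕ
countL []       C = 0
countL (x ∷ xs) C = (if C x then 1 else 0) + countL xs C

record State : Set where
  constructor st
  field
    matching : Matching
    acc      : VSet
open State public

initial : State
initial = st [] (λ _ → false)

-- matching phase for arriving vertex v with earlier neighbours ns
-- (the unsaturated neighbour p is chosen arbitrarily)
data MatchStep (v : ℕ) (ns : List ℕ) (M : Matching) : Matching → Set where
  add  : ∀ p → p ∈ ns → saturated M p ≡ false → MatchStep v ns M ((p , v) ∷ M)
  none : (∀ p → p ∈ ns → saturated M p ≡ true) → MatchStep v ns M M

-- statuses after the step, given the new matching M', the neighbours ns
-- of the new vertex, the old statuses, and the HalveBoth choice b for the
-- endpoints of e₁, e₂
assemble : Matching → List ℕ → VSet → VSet → VSet
assemble M' ns old b u =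
  if not (saturated M' u) then false
  else if inE1 M' u ∨ inE2 M' u then b u
  else if elem u ns then true
  else old u

-- HalveBoth objective (lexicographic):
--  (accepted endpoints of e₁,e₂ ; accepted endpoints of e₁ ;
--   late operations on previously revealed endpoints of e₁,e₂)
record Cost : Set where
  constructor cost
  field
    c₁ c₂ c₃ : ℕ

costOf : ℕ → Matching → VSet → VSet → Cost
costOf v M' old new =
  cost (countL (ends12 M') new)
       (countL (ends1 M') new)
       (countL (filterᵇ (λ u → not (u ≡ᵇ v)) (ends12 M')) (λ u → new u xor old u))

LexLe : Cost → Cost → Set
LexLe (cost a₁ a₂ a₃) (cost b₁ b₂ b₃) =
  a₁ < b₁ ⊎ (a₁ ≡ b₁ × (a₂ < b₂ ⊎ (a₂ ≡ b₂ × a₃ ≤ b₃)))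

data Step (G : Input) (ns : List ℕ) : State → State → Set where
  step : ∀ {M acc₀ M' b} →
         MatchStep (length G) ns M M' →
         IsVC (ns ∷ G) (assemble M' ns acc₀ b) →
         (∀ b' → IsVC (ns ∷ G) (assemble M' ns acc₀ b') →
            LexLe (costOf (length G) M' acc₀ (assemble M' ns acc₀ b))
                  (costOf (length G) M' acc₀ (assemble M' ns acc₀ b'))) →
         Step G ns (st M acc₀) (st M' (assemble M' ns acc₀ b))

data Run : Input → State → Set where
  start : Run [] initial
  next  : ∀ {G ns s s'} → Run G s → All (_< length G) ns → Step G ns s s' →
          Run (ns ∷ G) s'

-- OPT ∩ (e₁ ∪ (V ∖ V_M)) counted over revealed vertices
e1OrUnsat : Matching → VSet
e1OrUnsat M u = inE1 M u ∨ not (saturated M u)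

-- Along any run three facts persist: the accepted set is a vertex cover contained in V_M, the
-- matching is a matching of the revealed graph, and, by the late-acceptance rule, every saturated
-- neighbour of an endpoint of e₁ lying outside e₁ ∪ e₂ is accepted.
--
-- Let both endpoints of e₁ be accepted and let C be any vertex cover. If C misses an endpoint y
-- of e₁ and every vertex of C is saturated, then every neighbour of y is saturated, hence
-- accepted or an endpoint of e₂. So rejecting y and accepting both endpoints of e₂ is another
-- valid choice for HalveBoth; it accepts one endpoint of e₁ fewer and at most one endpoint of e₂
-- more (e₂ was already covered), contradicting the lexicographic optimality of the choice made.
-- Hence C meets e₁ ∪ (V ∖ V_M) at least twice. The remaining matching edges are disjoint from
-- this set and each contributes one more vertex of C, so |C| ≥ |M| + 1, while |DH| ≤ |V_M| = 2|M|.
module Submission where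

open import Defs
open import Data.Bool using (Bool; true; false; _∧_; _∨_; not; if_then_else_)
open import Data.Bool.Properties using (T-≡; ¬-not; not-¬; not-injective)
open import Data.Empty using (⊥-elim)
open import Data.List using (List; []; _∷_; length; _++_)
open import Data.List.Membership.Propositional using (_∈_)
open import Data.List.Relation.Unary.All using (All; []; _∷_; head; tail; lookupWith)
  renaming (map to All-map)
open import Data.List.Relation.Unary.Any as Any using ()
open import Data.List.Relation.Unary.Any.Properties using (any⁺; any⁻)
open import Data.Nat using (ℕ; zero; suc; _+_; _*_; _≤_; _<_; _≡ᵇ_; z≤n; s≤s)
open import Data.Nat.Properties
open import Algebra.Properties.CommutativeSemigroup +-commutativeSemigroup using (interchange)
open import Data.Nat.Tactic.RingSolver using (solve-∀)
open import Data.Product using (Σ; _×_; _,_; proj₁; proj₂)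
  renaming (map to ×-map)
open import Data.Sum using (_⊎_; inj₁; inj₂)
open import Data.Unit using (⊤; tt)
open import Function.Bundles using (Equivalence)
open import Relation.Binary.PropositionalEquality
open import Relation.Nullary using (¬_; yes; no)

true-or-false : ∀ x → x ≡ true ⊎ x ≡ false
true-or-false true  = inj₁ refl
true-or-false false = inj₂ refl

∨-≡true⁻ : ∀ {x y} → x ∨ y ≡ true → x ≡ true ⊎ y ≡ true
∨-≡true⁻ {true}  _ = inj₁ refl
∨-≡true⁻ {false} h = inj₂ h

∨-≡trueˡ : ∀ {x} y → x ≡ true → x ∨ y ≡ true
∨-≡trueˡ y refl = refl

∨-≡trueʳ : ∀ x {y} → y ≡ true → x ∨ y ≡ true
∨-≡trueʳ true  _ = refl
∨-≡trueʳ false h = h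

∨-≡false : ∀ {x y} → x ≡ false → y ≡ false → x ∨ y ≡ false
∨-≡false refl refl = refl

∨-≡false⁻ : ∀ {x y} → x ∨ y ≡ false → x ≡ false × y ≡ false
∨-≡false⁻ {false} h = refl , h

∧-≡true⁻ : ∀ {x y} → x ∧ y ≡ true → x ≡ true × y ≡ true
∧-≡true⁻ {true} h = refl , h

∧-not-≡false : ∀ {x y} → x ≡ true → x ∧ not y ≡ false → y ≡ true
∧-not-≡false {y = true}  _    _ = refl
∧-not-≡false {y = false} refl ()

true-false⇒≢ : ∀ {A : Set} (f : A → Bool) {x y} → f x ≡ true → f y ≡ false → x ≢ y
true-false⇒≢ f fx fy refl = not-¬ fx fy

≡ᵇ-refl : ∀ m → (m ≡ᵇ m) ≡ true
≡ᵇ-refl m = Equivalence.to T-≡ (≡⇒≡ᵇ m m refl)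

≡ᵇ-≡true⇒≡ : ∀ {m n} → (m ≡ᵇ n) ≡ true → m ≡ n
≡ᵇ-≡true⇒≡ {m} {n} h = ≡ᵇ⇒≡ m n (Equivalence.from T-≡ h)

≢⇒≡ᵇ-≡false : ∀ {m n} → m ≢ n → (m ≡ᵇ n) ≡ false
≢⇒≡ᵇ-≡false m≢n = ¬-not (λ h → m≢n (≡ᵇ-≡true⇒≡ h))

elem-∈ : ∀ {u ns} → u ∈ ns → elem u ns ≡ true
elem-∈ {u} u∈ns =
  Equivalence.to T-≡ (any⁺ (u ≡ᵇ_) (Any.map (λ { refl → ≡⇒≡ᵇ u u refl }) u∈ns))

elem-bounded : ∀ {k u ns} → All (_< k) ns → elem u ns ≡ true → u < k
elem-bounded {k} {u} {ns} ns<k h =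
  lookupWith (λ x<k u≡x → subst (_< k) (sym (≡ᵇ⇒≡ u _ u≡x)) x<k)
             ns<k (any⁻ (u ≡ᵇ_) ns (Equivalence.from T-≡ h))

Edge-sym : ∀ G {u w} → Edge G u w → Edge G w u
Edge-sym (ns ∷ G) (inj₁ e)        = inj₂ (inj₁ e)
Edge-sym (ns ∷ G) (inj₂ (inj₁ e)) = inj₁ e
Edge-sym (ns ∷ G) (inj₂ (inj₂ e)) = inj₂ (inj₂ (Edge-sym G e))

IsVC-trade : ∀ G {C C' : VSet} y → IsVC G C →
  (∀ u → u ≢ y → C u ≡ true → C' u ≡ true) → (∀ w → Edge G y w → C' w ≡ true) → IsVC G C'
IsVC-trade G y cover C⊆C' nbrs u w uw with u ≟ y | w ≟ y
... | yes refl | _        = inj₂ (nbrs w uw)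
... | no _     | yes refl = inj₁ (nbrs u (Edge-sym G uw))
... | no u≢y   | no w≢y   with cover u w uw
...   | inj₁ Cu = inj₁ (C⊆C' u u≢y Cu)
...   | inj₂ Cw = inj₂ (C⊆C' w w≢y Cw)

endpoint⁻ : ∀ {p v u} → endpoint (p , v) u ≡ true → p ≡ u ⊎ v ≡ u
endpoint⁻ {p} {v} {u} h with ∨-≡true⁻ {p ≡ᵇ u} h
... | inj₁ p≡u = inj₁ (≡ᵇ-≡true⇒≡ p≡u)
... | inj₂ v≡u = inj₂ (≡ᵇ-≡true⇒≡ v≡u)

endpointˡ : ∀ p v → endpoint (p , v) p ≡ true
endpointˡ p v = ∨-≡trueˡ (v ≡ᵇ p) (≡ᵇ-refl p)

endpointʳ : ∀ p v → endpoint (p , v) v ≡ true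
endpointʳ p v = ∨-≡trueʳ (p ≡ᵇ v) (≡ᵇ-refl v)

saturated-head : ∀ e M {u} → endpoint e u ≡ true → saturated (e ∷ M) u ≡ true
saturated-head e M {u} h = ∨-≡trueˡ (saturated M u) h

saturated-tail : ∀ e M {u} → saturated M u ≡ true → saturated (e ∷ M) u ≡ true
saturated-tail e M {u} h = ∨-≡trueʳ (endpoint e u) h

inE2-unsaturated : ∀ e {M u} → saturated M u ≡ false → inE2 (e ∷ M) u ≡ false
inE2-unsaturated e {[]}    _ = refl
inE2-unsaturated e {f ∷ M} h = proj₁ (∨-≡false⁻ h)

Disjoint : Matching → Set
Disjoint []      = ⊤
Disjoint (e ∷ M) = (∀ u → endpoint e u ≡ true → saturated M u ≡ false) × Disjoint M

MatchedEdge : Input → ℕ × ℕ → Set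
MatchedEdge G (p , v) = Edge G p v × p < v

E₁NeighboursAccepted : Input → Matching → VSet → Set
E₁NeighboursAccepted G []      A = ⊤
E₁NeighboursAccepted G (e ∷ M) A = ∀ x w → endpoint e x ≡ true → Edge G x w →
  saturated (e ∷ M) w ≡ true → inE1 (e ∷ M) w ≡ false → inE2 (e ∷ M) w ≡ false → A w ≡ true

assemble-saturated : ∀ M ns old b u → assemble M ns old b u ≡ true → saturated M u ≡ true
assemble-saturated M ns old b u h with saturated M u
... | true  = refl
... | false = h

assemble-e₁₂ : ∀ M ns old b u → saturated M u ≡ true → inE1 M u ∨ inE2 M u ≡ true →
  assemble M ns old b u ≡ b u
assemble-e₁₂ M ns old b u sat e₁₂ rewrite sat | e₁₂ = refl

assemble-late : ∀ M ns old b u → saturated M u ≡ true → inE1 M u ∨ inE2 M u ≡ false →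
  elem u ns ≡ true ⊎ old u ≡ true → assemble M ns old b u ≡ true
assemble-late M ns old b u sat e₁₂ (inj₁ nbr) rewrite sat | e₁₂ | nbr = refl
assemble-late M ns old b u sat e₁₂ (inj₂ acc) rewrite sat | e₁₂ | acc with elem u ns
... | true  = refl
... | false = refl

assemble-mono : ∀ M ns old b b' u → (b u ≡ true → b' u ≡ true) →
  assemble M ns old b u ≡ true → assemble M ns old b' u ≡ true
assemble-mono M ns old b b' u b⊆b' h with saturated M u | inE1 M u ∨ inE2 M u
... | false | _     = h
... | true  | true  = b⊆b' h
... | true  | false = h

ind : Bool → ℕ
ind x = if x then 1 else 0

ind≤1 : ∀ x → ind x ≤ 1
ind≤1 true  = ≤-refl
ind≤1 false = z≤n

ind-mono : ∀ {x y} → (x ≡ true → y ≡ true) → ind x ≤ ind y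
ind-mono {false} _ = z≤n
ind-mono {true}  h rewrite h refl = ≤-refl

find-below : ∀ n (f : VSet) → (Σ ℕ λ u → u < n × f u ≡ true) ⊎ (∀ u → u < n → f u ≡ false)
find-below zero    f = inj₂ (λ _ ())
find-below (suc n) f with f n in fn | find-below n f
... | true  | _                 = inj₁ (n , n<1+n n , fn)
... | false | inj₁ (u , u<n , fu) = inj₁ (u , m<n⇒m<1+n u<n , fu)
... | false | inj₂ absent       = inj₂ below
  where
  below : ∀ u → u < suc n → f u ≡ false
  below u u<1+n with m<1+n⇒m<n∨m≡n u<1+n
  ... | inj₁ u<n  = absent u u<n
  ... | inj₂ refl = fn

count-empty : ∀ n {f : VSet} → (∀ u → u < n → f u ≡ false) → count n f ≡ 0
count-empty zero    _      = refl
count-empty (suc n) absent rewrite absent n (n<1+n n) =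
  count-empty n (λ u u<n → absent u (m<n⇒m<1+n u<n))

count-mono : ∀ n {f g : VSet} → (∀ u → f u ≡ true → g u ≡ true) → count n f ≤ count n g
count-mono zero    f⊆g = z≤n
count-mono (suc n) f⊆g = +-mono-≤ (ind-mono (f⊆g n)) (count-mono n f⊆g)

count-strict : ∀ n {f g : VSet} {x} → (∀ u → f u ≡ true → g u ≡ true) → x < n →
  f x ≡ false → g x ≡ true → suc (count n f) ≤ count n g
count-strict (suc n) {f} {g} {x} f⊆g x<1+n fx gx with m<1+n⇒m<n∨m≡n x<1+n
... | inj₂ refl rewrite fx | gx = s≤s (count-mono n f⊆g)
... | inj₁ x<n = begin
  suc (ind (f n) + count n f) ≡⟨ +-suc (ind (f n)) (count n f) ⟨
  ind (f n) + suc (count n f) ≤⟨ +-mono-≤ (ind-mono (f⊆g n)) (count-strict n f⊆g x<n fx gx) ⟩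
  ind (g n) + count n g       ∎
  where open ≤-Reasoning

count-≥1 : ∀ n {f : VSet} {x} → x < n → f x ≡ true → 1 ≤ count n f
count-≥1 n {f} x<n fx =
  subst (λ k → suc k ≤ count n f) (count-empty n (λ _ _ → refl))
        (count-strict n {g = f} (λ _ ()) x<n refl fx)

count-≥2 : ∀ n {f : VSet} {x y} → x < n → y < n → x ≢ y → f x ≡ true → f y ≡ true → 2 ≤ count n f
count-≥2 n {f} {x} x<n y<n x≢y fx fy =
  ≤-trans (s≤s (count-≥1 n x<n (≡ᵇ-refl x))) (count-strict n only-x y<n (≢⇒≡ᵇ-≡false x≢y) fy)
  where
  only-x : ∀ u → (x ≡ᵇ u) ≡ true → f u ≡ true
  only-x u x≡u = subst (λ z → f z ≡ true) (≡ᵇ-≡true⇒≡ x≡u) fx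

count-singleton : ∀ n p → count n (p ≡ᵇ_) ≤ 1
count-singleton zero    p = z≤n
count-singleton (suc n) p with p ≟ n
... | yes refl rewrite ≡ᵇ-refl p | count-empty p (λ u u<p → ≢⇒≡ᵇ-≡false (>⇒≢ u<p)) = ≤-refl
... | no p≢n   rewrite ≢⇒≡ᵇ-≡false p≢n = count-singleton n p

count-∨ : ∀ n (f g : VSet) → count n (λ u → f u ∨ g u) ≤ count n f + count n g
count-∨ zero    f g = z≤n
count-∨ (suc n) f g = begin
  ind (f n ∨ g n) + count n (λ u → f u ∨ g u)         ≤⟨ +-mono-≤ (ind-∨ (f n) (g n)) (count-∨ n f g) ⟩
  (ind (f n) + ind (g n)) + (count n f + count n g)   ≡⟨ interchange (ind (f n)) _ _ _ ⟩
  (ind (f n) + count n f) + (ind (g n) + count n g)   ∎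
  where
  open ≤-Reasoning
  ind-∨ : ∀ x y → ind (x ∨ y) ≤ ind x + ind y
  ind-∨ true  y = s≤s z≤n
  ind-∨ false y = ≤-refl

countL-++ : ∀ xs ys C → countL (xs ++ ys) C ≡ countL xs C + countL ys C
countL-++ []       ys C = refl
countL-++ (x ∷ xs) ys C =
  trans (cong (ind (C x) +_) (countL-++ xs ys C)) (sym (+-assoc (ind (C x)) _ _))

countL-ends12 : ∀ e M C → countL (ends12 (e ∷ M)) C ≡ countL (ends1 (e ∷ M)) C + countL (ends1 M) C
countL-ends12 e []      C = countL-++ (ends1 (e ∷ [])) [] C
countL-ends12 e (f ∷ M) C = countL-++ (ends1 (e ∷ [])) (ends1 (f ∷ [])) C

countL-pair≤2 : ∀ p v C → countL (p ∷ v ∷ []) C ≤ 2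
countL-pair≤2 p v C = +-mono-≤ (ind≤1 (C p)) (+-mono-≤ (ind≤1 (C v)) z≤n)

countL-pair≥1 : ∀ {p v} C → C p ≡ true ⊎ C v ≡ true → 1 ≤ countL (p ∷ v ∷ []) C
countL-pair≥1     C (inj₁ Cp) rewrite Cp = s≤s z≤n
countL-pair≥1 {p} C (inj₂ Cv) rewrite Cv = m≤n+m 1 (ind (C p))

countL-pair≡1 : ∀ {p v} C → (C p ≡ true × C v ≡ false) ⊎ (C p ≡ false × C v ≡ true) →
  countL (p ∷ v ∷ []) C ≡ 1
countL-pair≡1 C (inj₁ (Cp , Cv)) rewrite Cp | Cv = refl
countL-pair≡1 C (inj₂ (Cp , Cv)) rewrite Cp | Cv = refl

countL-pair≡2 : ∀ {p v} C → C p ≡ true → C v ≡ true → countL (p ∷ v ∷ []) C ≡ 2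
countL-pair≡2 C Cp Cv rewrite Cp | Cv = refl

countL-ends1-≤ : ∀ {G} M C D → All (MatchedEdge G) M → IsVC G D →
  countL (ends1 M) C ≤ suc (countL (ends1 M) D)
countL-ends1-≤ []            C D _              _     = z≤n
countL-ends1-≤ ((p , v) ∷ M) C D ((pv , _) ∷ _) cover =
  ≤-trans (countL-pair≤2 p v C) (s≤s (countL-pair≥1 D (cover p v pv)))

count-saturated : ∀ n M → count n (saturated M) ≤ 2 * length M
count-saturated n []            = ≤-reflexive (count-empty n (λ _ _ → refl))
count-saturated n ((p , v) ∷ M) = begin
  count n (saturated ((p , v) ∷ M))                 ≤⟨ count-∨ n (endpoint (p , v)) (saturated M) ⟩
  count n (endpoint (p , v)) + count n (saturated M) ≤⟨ +-mono-≤ endpoints (count-saturated n M) ⟩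
  2 + 2 * length M                                  ≡⟨ *-suc 2 (length M) ⟨
  2 * suc (length M)                                ∎
  where
  open ≤-Reasoning
  endpoints : count n (endpoint (p , v)) ≤ 2
  endpoints = ≤-trans (count-∨ n (p ≡ᵇ_) (v ≡ᵇ_))
                      (+-mono-≤ (count-singleton n p) (count-singleton n v))

matching-lower-bound : ∀ {G} n (C : VSet) → IsVC G C → ∀ M → Disjoint M → All (MatchedEdge G) M →
  (∀ u → saturated M u ≡ true → u < n) → ∀ (S : VSet) → (∀ u → S u ≡ true → saturated M u ≡ false) →
  length M + count n (λ u → C u ∧ S u) ≤ count n C
matching-lower-bound n C cover [] _ _ _ S _ = count-mono n (λ u h → proj₁ (∧-≡true⁻ {C u} h))
matching-lower-bound n C cover ((p , v) ∷ M) (fresh , disjoint) ((pv , _) ∷ edges)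
                     bounded S S-free = begin
    suc (length M) + count n (λ u → C u ∧ S u)   ≡⟨ +-suc (length M) _ ⟨
    length M + suc (count n (λ u → C u ∧ S u))   ≤⟨ +-monoʳ-≤ (length M) (grow (cover p v pv)) ⟩
    length M + count n (λ u → C u ∧ S' u)        ≤⟨ matching-lower-bound n C cover M disjoint edges
                                                       bounded-M S' S'-free ⟩
    count n C                                    ∎
  where
  open ≤-Reasoning
  bounded-M : ∀ u → saturated M u ≡ true → u < n
  bounded-M u h = bounded u (saturated-tail (p , v) M h)
  S' : VSet
  S' u = S u ∨ endpoint (p , v) u
  S'-free : ∀ u → S' u ≡ true → saturated M u ≡ false
  S'-free u h with ∨-≡true⁻ {S u} h
  ... | inj₁ Su = proj₂ (∨-≡false⁻ (S-free u Su))
  ... | inj₂ eu = fresh u eu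
  S⊆S' : ∀ u → C u ∧ S u ≡ true → C u ∧ S' u ≡ true
  S⊆S' u h with ∧-≡true⁻ {C u} h
  ... | Cu , Su rewrite Cu | Su = refl
  grow-at : ∀ {x} → endpoint (p , v) x ≡ true → C x ≡ true →
    suc (count n (λ u → C u ∧ S u)) ≤ count n (λ u → C u ∧ S' u)
  grow-at {x} ex Cx = count-strict n S⊆S' (bounded x (saturated-head (p , v) M ex)) outside inside
    where
    Sx : S x ≡ false
    Sx = ¬-not (λ Sx → not-¬ (saturated-head (p , v) M ex) (S-free x Sx))
    outside : C x ∧ S x ≡ false
    outside rewrite Cx | Sx = refl
    inside : C x ∧ S' x ≡ true
    inside rewrite Cx | Sx = ex
  grow : C p ≡ true ⊎ C v ≡ true → suc (count n (λ u → C u ∧ S u)) ≤ count n (λ u → C u ∧ S' u)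
  grow (inj₁ Cp) = grow-at (endpointˡ p v) Cp
  grow (inj₂ Cv) = grow-at (endpointʳ p v) Cv

record Invariant (G : Input) (s : State) : Set where
  field
    edge-bounded      : ∀ u w → Edge G u w → u < length G × w < length G
    cover             : IsVC G (acc s)
    acc⇒saturated     : ∀ u → acc s u ≡ true → saturated (matching s) u ≡ true
    saturated-bounded : ∀ u → saturated (matching s) u ≡ true → u < length G
    matched-edges     : All (MatchedEdge G) (matching s)
    disjoint          : Disjoint (matching s)
    e₁-nbrs-accepted  : E₁NeighboursAccepted G (matching s) (acc s)

E₁NeighboursAccepted-persists : ∀ {G} ns M {old b} → (∀ u → saturated M u ≡ true → u < length G) →
  E₁NeighboursAccepted G M old → E₁NeighboursAccepted (ns ∷ G) M (assemble M ns old b)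
E₁NeighboursAccepted-persists ns [] _ _ = tt
E₁NeighboursAccepted-persists ns (e ∷ M) {old} {b} bounded accepted x w ex xw sw w∉e₁ w∉e₂ =
  assemble-late (e ∷ M) ns old b w sw (∨-≡false w∉e₁ w∉e₂) (inj₂ (old-edge xw))
  where
  old-edge : Edge (ns ∷ _) x w → old w ≡ true
  old-edge (inj₁ (refl , _))        = ⊥-elim (<-irrefl refl (bounded w sw))
  old-edge (inj₂ (inj₁ (refl , _))) = ⊥-elim (<-irrefl refl (bounded x (saturated-head e M ex)))
  old-edge (inj₂ (inj₂ xw))         = accepted x w ex xw sw w∉e₁ w∉e₂

module InvariantStep {G : Input} {ns : List ℕ} {M : Matching} {acc₀ : VSet}
  (I : Invariant G (st M acc₀)) (ns<v : All (_< length G) ns) where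

  open Invariant I

  v : ℕ
  v = length G

  neighbour<v : ∀ {u} → u ∈ ns → u < v
  neighbour<v u∈ns = elem-bounded ns<v (elem-∈ u∈ns)

  edge-bounded′ : ∀ u w → Edge (ns ∷ G) u w → u < suc v × w < suc v
  edge-bounded′ u w (inj₁ (refl , u∈ns))        = m<n⇒m<1+n (elem-bounded ns<v u∈ns) , n<1+n v
  edge-bounded′ u w (inj₂ (inj₁ (refl , w∈ns))) = n<1+n v , m<n⇒m<1+n (elem-bounded ns<v w∈ns)
  edge-bounded′ u w (inj₂ (inj₂ uw))            = ×-map m<n⇒m<1+n m<n⇒m<1+n (edge-bounded u w uw)

  saturated-bounded′ : ∀ {M'} → MatchStep v ns M M' → ∀ u → saturated M' u ≡ true → u < suc v
  saturated-bounded′ (add p p∈ns _) u h with ∨-≡true⁻ {endpoint (p , v) u} h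
  ... | inj₂ old = m<n⇒m<1+n (saturated-bounded u old)
  ... | inj₁ pv with endpoint⁻ {p} {v} pv
  ...   | inj₁ refl = m<n⇒m<1+n (neighbour<v p∈ns)
  ...   | inj₂ refl = n<1+n v
  saturated-bounded′ (none _) u h = m<n⇒m<1+n (saturated-bounded u h)

  old-edges : All (MatchedEdge (ns ∷ G)) M
  old-edges = All-map (λ { (pv , p<v) → inj₂ (inj₂ pv) , p<v }) matched-edges

  matched-edges′ : ∀ {M'} → MatchStep v ns M M' → All (MatchedEdge (ns ∷ G)) M'
  matched-edges′ (add p p∈ns _) = (inj₁ (refl , elem-∈ p∈ns) , neighbour<v p∈ns) ∷ old-edges
  matched-edges′ (none _)       = old-edges

  disjoint′ : ∀ {M'} → MatchStep v ns M M' → Disjoint M'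
  disjoint′ (add p _ p-free) = fresh , disjoint
    where
    fresh : ∀ u → endpoint (p , v) u ≡ true → saturated M u ≡ false
    fresh u pv with endpoint⁻ {p} {v} pv
    ... | inj₁ refl = p-free
    ... | inj₂ refl = ¬-not (λ sv → <-irrefl refl (saturated-bounded v sv))
  disjoint′ (none _) = disjoint

  e₁-nbrs-accepted′ : ∀ {M' b} → MatchStep v ns M M' →
    E₁NeighboursAccepted (ns ∷ G) M' (assemble M' ns acc₀ b)
  e₁-nbrs-accepted′ {b = b} (add p p∈ns p-free) x w ex xw sw w∉e₁ w∉e₂ =
    assemble-late ((p , v) ∷ M) ns acc₀ b w sw (∨-≡false w∉e₁ w∉e₂)
                  (late (endpoint⁻ {p} {v} ex) xw)
    where
    late : p ≡ x ⊎ v ≡ x → Edge (ns ∷ G) x w → elem w ns ≡ true ⊎ acc₀ w ≡ true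
    late _           (inj₁ (refl , _))         = ⊥-elim (not-¬ (endpointʳ p v) w∉e₁)
    late (inj₁ refl) (inj₂ (inj₁ (p≡v , _)))   = ⊥-elim (<⇒≢ (neighbour<v p∈ns) p≡v)
    late (inj₂ refl) (inj₂ (inj₁ (_ , w∈ns)))  = inj₁ w∈ns
    late (inj₂ refl) (inj₂ (inj₂ vw))          = ⊥-elim (<-irrefl refl (proj₁ (edge-bounded _ _ vw)))
    -- p was unsaturated, hence rejected, so the old cover accepted its old neighbours.
    late (inj₁ refl) (inj₂ (inj₂ pw)) with cover p w pw
    ... | inj₁ p-acc = ⊥-elim (not-¬ (acc⇒saturated p p-acc) p-free)
    ... | inj₂ w-acc = inj₂ w-acc
  e₁-nbrs-accepted′ (none _) = E₁NeighboursAccepted-persists ns M saturated-bounded e₁-nbrs-accepted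

run⇒invariant : ∀ {G s} → Run G s → Invariant G s
run⇒invariant start = record
  { edge-bounded = λ _ _ (); cover = λ _ _ (); acc⇒saturated = λ _ (); saturated-bounded = λ _ ()
  ; matched-edges = []; disjoint = tt; e₁-nbrs-accepted = tt }
run⇒invariant (next {ns = ns} run ns<v (step {acc₀ = acc₀} {M'} {b} matchStep cover′ _)) = record
  { edge-bounded      = edge-bounded′
  ; cover             = cover′
  ; acc⇒saturated     = assemble-saturated M' ns acc₀ b
  ; saturated-bounded = saturated-bounded′ matchStep
  ; matched-edges     = matched-edges′ matchStep
  ; disjoint          = disjoint′ matchStep
  ; e₁-nbrs-accepted  = e₁-nbrs-accepted′ matchStep }
  where open InvariantStep (run⇒invariant run) ns<v

HalveBothOptimal : Input → List ℕ → Matching → VSet → VSet → Set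
HalveBothOptimal G ns M acc₀ b = ∀ b' → IsVC (ns ∷ G) (assemble M ns acc₀ b') →
  LexLe (costOf (length G) M acc₀ (assemble M ns acc₀ b))
        (costOf (length G) M acc₀ (assemble M ns acc₀ b'))

≤∧<⇒¬LexLe : ∀ {p q r s t u} → q ≤ p → s < r → ¬ LexLe (cost p r t) (cost q s u)
≤∧<⇒¬LexLe q≤p s<r (inj₁ p<q)                = <⇒≱ p<q q≤p
≤∧<⇒¬LexLe q≤p s<r (inj₂ (_ , inj₁ r<s))       = <-asym r<s s<r
≤∧<⇒¬LexLe q≤p s<r (inj₂ (_ , inj₂ (r≡s , _))) = <-irrefl (sym r≡s) s<r

module HalveBothExchange {G : Input} {ns : List ℕ} {acc₀ b : VSet} {a c : ℕ} {rest : Matching}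
  (I : Invariant (ns ∷ G) (st ((a , c) ∷ rest) (assemble ((a , c) ∷ rest) ns acc₀ b)))
  (optimal : HalveBothOptimal G ns ((a , c) ∷ rest) acc₀ b)
  (a-acc : assemble ((a , c) ∷ rest) ns acc₀ b a ≡ true)
  (c-acc : assemble ((a , c) ∷ rest) ns acc₀ b c ≡ true) where

  open Invariant I

  M : Matching
  M = (a , c) ∷ rest

  A : VSet
  A = assemble M ns acc₀ b

  n : ℕ
  n = suc (length G)

  a≢c : a ≢ c
  a≢c = <⇒≢ (proj₂ (head matched-edges))

  e₁-edge : Edge (ns ∷ G) a c
  e₁-edge = proj₁ (head matched-edges)

  e₁-accepted : ∀ {u} → endpoint (a , c) u ≡ true → A u ≡ true
  e₁-accepted {u} h with endpoint⁻ {a} {c} h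
  ... | inj₁ refl = a-acc
  ... | inj₂ refl = c-acc

  e₁-bounded : ∀ {u} → endpoint (a , c) u ≡ true → u < n
  e₁-bounded {u} h = saturated-bounded u (saturated-head (a , c) rest h)

  trade-for-e₂ : ℕ → VSet
  trade-for-e₂ y u = if inE2 M u then true else if y ≡ᵇ u then false else b u

  A-traded : ℕ → VSet
  A-traded y = assemble M ns acc₀ (trade-for-e₂ y)

  traded-⊇ : ∀ y u → u ≢ y → A u ≡ true → A-traded y u ≡ true
  traded-⊇ y u u≢y = assemble-mono M ns acc₀ b (trade-for-e₂ y) u keep
    where
    keep : b u ≡ true → trade-for-e₂ y u ≡ true
    keep bu with inE2 M u
    ... | true  = refl
    ... | false rewrite ≢⇒≡ᵇ-≡false (λ y≡u → u≢y (sym y≡u)) = bu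

  traded-e₂ : ∀ y u → saturated M u ≡ true → inE2 M u ≡ true → A-traded y u ≡ true
  traded-e₂ y u su e₂u
    rewrite assemble-e₁₂ M ns acc₀ (trade-for-e₂ y) u su (∨-≡trueʳ (inE1 M u) e₂u) | e₂u
    = refl

  traded-rejects : ∀ y → endpoint (a , c) y ≡ true → A-traded y y ≡ false
  traded-rejects y ey
    rewrite assemble-e₁₂ M ns acc₀ (trade-for-e₂ y) y (saturated-head (a , c) rest ey)
                         (∨-≡trueˡ (inE2 M y) ey)
          | inE2-unsaturated (a , c) {rest} (proj₁ disjoint y ey) | ≡ᵇ-refl y
    = refl

  traded-accepts-nbrs : ∀ y w → endpoint (a , c) y ≡ true → Edge (ns ∷ G) y w → w ≢ y →
    saturated M w ≡ true → A-traded y w ≡ true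
  traded-accepts-nbrs y w ey yw w≢y sw with true-or-false (inE2 M w) | true-or-false (inE1 M w)
  ... | inj₁ e₂w | _        = traded-e₂ y w sw e₂w
  ... | inj₂ _   | inj₁ e₁w = traded-⊇ y w w≢y (e₁-accepted e₁w)
  ... | inj₂ e₂w | inj₂ e₁w = traded-⊇ y w w≢y (e₁-nbrs-accepted y w ey yw sw e₁w e₂w)

  traded-covers : ∀ (C : VSet) → IsVC (ns ∷ G) C →
    (∀ u → u < n → C u ≡ true → saturated M u ≡ true) → ∀ y → endpoint (a , c) y ≡ true → C y ≡ false → IsVC (ns ∷ G) (A-traded y)
  traded-covers C C-cover C⊆V_M y ey Cy = IsVC-trade (ns ∷ G) y cover (traded-⊇ y) nbr
    where
    nbr : ∀ w → Edge (ns ∷ G) y w → A-traded y w ≡ true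
    nbr w yw with C-cover y w yw
    ... | inj₁ Cy′ = ⊥-elim (not-¬ Cy′ Cy)
    ... | inj₂ Cw  = traded-accepts-nbrs y w ey yw (true-false⇒≢ C Cw Cy)
                       (C⊆V_M w (proj₂ (edge-bounded y w yw)) Cw)

  traded-e₁ : ∀ y → endpoint (a , c) y ≡ true → countL (ends1 M) (A-traded y) ≡ 1
  traded-e₁ y ey with endpoint⁻ {a} {c} ey
  ... | inj₁ refl = countL-pair≡1 (A-traded y)
                      (inj₂ (traded-rejects y ey , traded-⊇ y c (≢-sym a≢c) c-acc))
  ... | inj₂ refl = countL-pair≡1 (A-traded y)
                      (inj₁ (traded-⊇ y a a≢c a-acc , traded-rejects y ey))

  traded-undercuts : ∀ y → endpoint (a , c) y ≡ true →
    ¬ LexLe (costOf (length G) M acc₀ A) (costOf (length G) M acc₀ (A-traded y))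
  traded-undercuts y ey =
    ≤∧<⇒¬LexLe e₁₂-total (subst₂ _<_ (sym (traded-e₁ y ey)) (sym e₁-both) ≤-refl)
    where
    open ≤-Reasoning
    e₁-both : countL (ends1 M) A ≡ 2
    e₁-both = countL-pair≡2 A a-acc c-acc
    e₂-gain : countL (ends1 rest) (A-traded y) ≤ suc (countL (ends1 rest) A)
    e₂-gain = countL-ends1-≤ {ns ∷ G} rest (A-traded y) A (tail matched-edges) cover
    e₁₂-total : countL (ends12 M) (A-traded y) ≤ countL (ends12 M) A
    e₁₂-total = begin
      countL (ends12 M) (A-traded y)
        ≡⟨ countL-ends12 (a , c) rest (A-traded y) ⟩
      countL (ends1 M) (A-traded y) + countL (ends1 rest) (A-traded y)
        ≡⟨ cong (_+ countL (ends1 rest) (A-traded y)) (traded-e₁ y ey) ⟩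
      1 + countL (ends1 rest) (A-traded y)
        ≤⟨ s≤s e₂-gain ⟩
      2 + countL (ends1 rest) A
        ≡⟨ cong (_+ countL (ends1 rest) A) e₁-both ⟨
      countL (ends1 M) A + countL (ends1 rest) A
        ≡⟨ countL-ends12 (a , c) rest A ⟨
      countL (ends12 M) A ∎

  cover-meets-unsaturated : ∀ (C : VSet) → IsVC (ns ∷ G) C → ∀ y → endpoint (a , c) y ≡ true →
    C y ≡ false → Σ ℕ λ u → u < n × C u ≡ true × saturated M u ≡ false
  cover-meets-unsaturated C C-cover y ey Cy with find-below n (λ u → C u ∧ not (saturated M u))
  ... | inj₁ (u , u<n , h) with ∧-≡true⁻ {C u} h
  ...   | Cu , unsat = u , u<n , Cu , not-injective {y = false} unsat
  cover-meets-unsaturated C C-cover y ey Cy | inj₂ absent =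
    ⊥-elim (traded-undercuts y ey
              (optimal (trade-for-e₂ y) (traded-covers C C-cover C⊆V_M y ey Cy)))
    where
    C⊆V_M : ∀ u → u < n → C u ≡ true → saturated M u ≡ true
    C⊆V_M u u<n Cu = ∧-not-≡false Cu (absent u u<n)

  in-e₁ : ∀ (C : VSet) {x} → endpoint (a , c) x ≡ true → C x ≡ true → C x ∧ e1OrUnsat M x ≡ true
  in-e₁ C ex Cx rewrite Cx = ∨-≡trueˡ _ ex

  in-unsaturated : ∀ (C : VSet) {u} → C u ≡ true → saturated M u ≡ false →
    C u ∧ e1OrUnsat M u ≡ true
  in-unsaturated C {u} Cu su rewrite Cu | su = ∨-≡trueʳ (inE1 M u) refl

  cover-meets-e₁-and-unsaturated : ∀ (C : VSet) → IsVC (ns ∷ G) C → ∀ {x y} →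
    endpoint (a , c) x ≡ true → endpoint (a , c) y ≡ true → C x ≡ true → C y ≡ false →
    2 ≤ count n (λ u → C u ∧ e1OrUnsat M u)
  cover-meets-e₁-and-unsaturated C C-cover ex ey Cx Cy
    with cover-meets-unsaturated C C-cover _ ey Cy
  ... | u , u<n , Cu , su =
    count-≥2 n (e₁-bounded ex) u<n (true-false⇒≢ (saturated M) (saturated-head (a , c) rest ex) su)
               (in-e₁ C ex Cx) (in-unsaturated C Cu su)

  cover-meets-e₁∪unsaturated-twice : ∀ (C : VSet) → IsVC (ns ∷ G) C →
    2 ≤ count n (λ u → C u ∧ e1OrUnsat M u)
  cover-meets-e₁∪unsaturated-twice C C-cover with C a in Ca | C c in Cc
  ... | true  | true  =
    count-≥2 n (e₁-bounded (endpointˡ a c)) (e₁-bounded (endpointʳ a c)) a≢c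
               (in-e₁ C (endpointˡ a c) Ca) (in-e₁ C (endpointʳ a c) Cc)
  ... | true  | false =
    cover-meets-e₁-and-unsaturated C C-cover (endpointˡ a c) (endpointʳ a c) Ca Cc
  ... | false | true  =
    cover-meets-e₁-and-unsaturated C C-cover (endpointʳ a c) (endpointˡ a c) Cc Ca
  ... | false | false with C-cover a c e₁-edge
  ...   | inj₁ Ca′ = ⊥-elim (not-¬ Ca′ Ca)
  ...   | inj₂ Cc′ = ⊥-elim (not-¬ Cc′ Cc)

approximation : ∀ {G e rest A} → Invariant G (st (e ∷ rest) A) → ∀ (C : VSet) → IsVC G C →
  2 ≤ count (length G) (λ u → C u ∧ e1OrUnsat (e ∷ rest) u) →
  count (length G) A + 2 ≤ 2 * count (length G) C
approximation {G} {e} {rest} {A} I C C-cover twice = begin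
  count n A + 2                   ≤⟨ +-monoˡ-≤ 2 accepted ⟩
  2 * suc (length rest) + 2       ≡⟨ double-plus-two (length rest) ⟩
  2 * (length rest + 2)           ≤⟨ *-monoʳ-≤ 2 (+-monoʳ-≤ (length rest) twice) ⟩
  2 * (length rest + count n S∩C) ≤⟨ *-monoʳ-≤ 2 lower ⟩
  2 * count n C                   ∎
  where
  open ≤-Reasoning
  open Invariant I
  n : ℕ
  n = length G
  S∩C : VSet
  S∩C u = C u ∧ e1OrUnsat (e ∷ rest) u
  double-plus-two : ∀ L → 2 * suc L + 2 ≡ 2 * (L + 2)
  double-plus-two = solve-∀
  accepted : count n A ≤ 2 * suc (length rest)
  accepted = ≤-trans (count-mono n acc⇒saturated) (count-saturated n (e ∷ rest))
  outside-rest : ∀ u → e1OrUnsat (e ∷ rest) u ≡ true → saturated rest u ≡ false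
  outside-rest u h with ∨-≡true⁻ {inE1 (e ∷ rest) u} h
  ... | inj₁ e₁u   = proj₁ disjoint u e₁u
  ... | inj₂ unsat = proj₂ (∨-≡false⁻ {endpoint e u} (not-injective {y = false} unsat))
  lower : length rest + count n S∩C ≤ count n C
  lower = matching-lower-bound n C C-cover rest (proj₂ disjoint) (tail matched-edges)
            (λ u h → saturated-bounded u (saturated-tail e rest h))
            (e1OrUnsat (e ∷ rest)) outside-rest

mainTheorem12 : ∀ (G : Input) (s : State) → Run G s →
    ∀ (a c : ℕ) (rest : Matching) → matching s ≡ (a , c) ∷ rest →
    acc s a ≡ true → acc s c ≡ true →
    ∀ (OPT : VSet) → IsMinVC G OPT →
    (2 ≤ count (length G) (λ u → OPT u ∧ e1OrUnsat (matching s) u))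
    × (count (length G) (acc s) + 2 ≤ 2 * count (length G) OPT)
mainTheorem12 _ _ start _ _ _ () _ _ _ _
mainTheorem12 _ _ run@(next _ _ (step _ _ optimal)) a c rest refl a-acc c-acc OPT (OPT-cover , _) =
  twice , approximation (run⇒invariant run) OPT OPT-cover twice
  where
  open HalveBothExchange (run⇒invariant run) optimal a-acc c-acc
    using (n; M; cover-meets-e₁∪unsaturated-twice)
  twice : 2 ≤ count n (λ u → OPT u ∧ e1OrUnsat M u)
  twice = cover-meets-e₁∪unsaturated-twice OPT OPT-cover
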